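{- Let $q$ be a power of a prime $p$ and $k\in\mathbb{N}$. Write $k=d\cdot q+r$ with $1\le d<p$ and $0\le r<q$, and assume $d-1\le r$. Let $1\le m\le d$. Then the matrix $A\in\mathbb{F}_{p}^{m\times m}$ with entries $A_{il}=\binom{k-i+1}{m+l(q-1)}\bmod p$ for $i,l=1,\dots,m$ is nonsingular. -}

module Defs where

open import Data.Nat using (ℕ; zero; suc; _+_; _*_; _∸_; _%_; NonZero)
open import Data.Nat.Combinatorics using (_C_)
open import Data.Nat.Primality using (Prime; prime⇒nonZero)
open import Data.Fin using (Fin; zero; suc; toℕ; punchIn)
open import Data.Integer as ℤ using (ℤ; +_)
open import Data.Nat.Divisibility using (_∣_)
open import Relation.Nullary using (¬_)

Matrix : ℕ → Set
Matrix n = Fin n → Fin n → ℤ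

∑ : ∀ n → (Fin n → ℤ) → ℤ
∑ zero    f = + 0
∑ (suc n) f = f zero ℤ.+ ∑ n (λ j → f (suc j))

sgn : ℕ → ℤ
sgn zero          = + 1
sgn (suc zero)    = ℤ.- (+ 1)
sgn (suc (suc j)) = sgn j

minor : ∀ {n} → Matrix (suc n) → Fin (suc n) → Matrix n
minor A j i l = A (suc i) (punchIn j l)

det : ∀ n → Matrix n → ℤ
det zero    A = + 1
det (suc n) A = ∑ (suc n) (λ j → sgn (toℕ j) ℤ.* (A zero j ℤ.* det n (minor A j)))

-- A matrix with entries in F_p (represented by integer representatives)
-- is nonsingular over F_p iff its determinant is nonzero in F_p,
-- i.e. p does not divide the integer determinant.
NonsingularModP : (p : ℕ) → ∀ n → Matrix n → Set
NonsingularModP p n A = ¬ (p ∣ ℤ.∣ det n A ∣)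

-- The matrix A_{il} = binom(k - i + 1, m + l(q-1)) mod p, with i,l = 1..m.
-- With 0-based indices i' = i-1, l' = l-1: entry binom(k - i', m + (l'+1)(q-1)) mod p.
binomMatrix : (p : ℕ) → Prime p → (k q m : ℕ) → Matrix m
binomMatrix p pp k q m i l =
  + (((k ∸ toℕ i) C (m + suc (toℕ l) * (q ∸ 1))) % p)
  where instance _ = prime⇒nonZero pp

module Submission where

-- Index rows and columns from 0 and write m = m′ + 1.  As i ≤ m′ ≤ d − 1 ≤ r, the entry
-- in row i and column l is C(d·q + (r − i), (l+1)·q + (m′ − l)) with both lower digits
-- below q, so Lucas' theorem for one q-adic digit (available because p divides C(p^e, j)
-- for 0 < j < p^e) gives  A_{il} ≡ C(d, l+1) · C(r − i, m′ − l)  (mod p).  Repeatedly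
-- subtracting the next row (Pascal's rule) makes [c_l · C(r − i, m′ − l)] lower
-- triangular with diagonal c, so its determinant is ∏ c_l = ∏ C(d, l+1), and no factor
-- is divisible by p because d < p.

open import Defs
open import Data.Nat using (ℕ; zero; suc; _<_)
open import Data.Nat.Divisibility using (_∣_)
open import Data.Nat.Primality using (Prime)
open import Data.Fin using (Fin; zero; suc; toℕ; punchIn)
open import Relation.Binary.PropositionalEquality

-- Determinants computed by Laplace expansion along the first row: the expansion is linear
-- in the first row and vanishes when the first two rows agree, so subtracting the next
-- row preserves the determinant; triangular determinants are diagonal products.
module Determinant where

  open import Data.Nat using (_≤_; s≤s; z≤n)
  open import Data.Fin using (lift)
  open import Data.Integer using (ℤ; +_; _+_; _*_; -_; _-_)
  open import Data.Integer.Properties using (neg-distrib-+; +-identityʳ)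
  open import Data.Integer.Tactic.RingSolver using (solve-∀)
  open ≡-Reasoning

  ∑-cong : ∀ n {f g : Fin n → ℤ} → (∀ i → f i ≡ g i) → ∑ n f ≡ ∑ n g
  ∑-cong zero    f≡g = refl
  ∑-cong (suc n) f≡g = cong₂ _+_ (f≡g zero) (∑-cong n (λ i → f≡g (suc i)))

  ∑-+ : ∀ n (f g : Fin n → ℤ) → ∑ n (λ i → f i + g i) ≡ ∑ n f + ∑ n g
  ∑-+ zero    f g = refl
  ∑-+ (suc n) f g = begin
    f zero + g zero + ∑ n (λ i → f (suc i) + g (suc i))
      ≡⟨ cong (λ s → f zero + g zero + s) (∑-+ n (λ i → f (suc i)) (λ i → g (suc i))) ⟩
    f zero + g zero + (∑ n (λ i → f (suc i)) + ∑ n (λ i → g (suc i)))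
      ≡⟨ interchange (f zero) (g zero) _ _ ⟩
    f zero + ∑ n (λ i → f (suc i)) + (g zero + ∑ n (λ i → g (suc i))) ∎
    where
    interchange : ∀ a b c d → a + b + (c + d) ≡ a + c + (b + d)
    interchange = solve-∀

  ∑-scale : ∀ n c (f : Fin n → ℤ) → ∑ n (λ i → c * f i) ≡ c * ∑ n f
  ∑-scale zero    c f = annihilate c
    where
    annihilate : ∀ c → + 0 ≡ c * + 0
    annihilate = solve-∀
  ∑-scale (suc n) c f = begin
    c * f zero + ∑ n (λ i → c * f (suc i)) ≡⟨ cong (λ s → c * f zero + s) (∑-scale n c (λ i → f (suc i))) ⟩
    c * f zero + c * ∑ n (λ i → f (suc i)) ≡⟨ distrib c (f zero) _ ⟩
    c * (f zero + ∑ n (λ i → f (suc i)))   ∎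
    where
    distrib : ∀ c a b → c * a + c * b ≡ c * (a + b)
    distrib = solve-∀

  ∑-neg : ∀ n (f : Fin n → ℤ) → ∑ n (λ i → - f i) ≡ - ∑ n f
  ∑-neg zero    f = refl
  ∑-neg (suc n) f = begin
    - f zero + ∑ n (λ i → - f (suc i)) ≡⟨ cong (λ s → - f zero + s) (∑-neg n (λ i → f (suc i))) ⟩
    - f zero + - ∑ n (λ i → f (suc i)) ≡⟨ neg-distrib-+ (f zero) _ ⟨
    - (f zero + ∑ n (λ i → f (suc i))) ∎

  ∑-zero : ∀ n (f : Fin n → ℤ) → (∀ i → f i ≡ + 0) → ∑ n f ≡ + 0
  ∑-zero zero    f f≡0 = refl
  ∑-zero (suc n) f f≡0 = cong₂ _+_ (f≡0 zero) (∑-zero n (λ i → f (suc i)) (λ i → f≡0 (suc i)))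

  sgn-suc : ∀ j → sgn (suc j) ≡ - sgn j
  sgn-suc zero          = refl
  sgn-suc (suc zero)    = refl
  sgn-suc (suc (suc j)) = sgn-suc j

  -- Laplace expansion along a first row b, where F σ is the minor complementary to
  -- the columns σ that avoid the chosen column.
  expansion : ∀ n → (Fin (suc n) → ℤ) → ((Fin n → Fin (suc n)) → ℤ) → ℤ
  expansion n b F = ∑ (suc n) (λ j → sgn (toℕ j) * (b j * F (punchIn j)))

  -- The minor of the rows below the first one, restricted to the columns σ;
  -- by definition det (suc n) A ≡ expansion n (A zero) (lowerMinor A).
  lowerMinor : ∀ {n} → Matrix (suc n) → (Fin n → Fin (suc n)) → ℤ
  lowerMinor {n} A σ = det n (λ i l → A (suc i) (σ l))

  expansion-congʳ : ∀ n b {F G : (Fin n → Fin (suc n)) → ℤ} → (∀ σ → F σ ≡ G σ) →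
                    expansion n b F ≡ expansion n b G
  expansion-congʳ n b F≡G = ∑-cong (suc n) (λ j → cong (λ x → sgn (toℕ j) * (b j * x)) (F≡G (punchIn j)))

  expansion-linear : ∀ n (b c : Fin (suc n) → ℤ) F →
                     expansion n (λ j → b j - c j) F ≡ expansion n b F - expansion n c F
  expansion-linear n b c F = begin
    expansion n (λ j → b j - c j) F
      ≡⟨ ∑-cong (suc n) (λ j → distrib (sgn (toℕ j)) (b j) (c j) (F (punchIn j))) ⟩
    ∑ (suc n) (λ j → sgn (toℕ j) * (b j * F (punchIn j)) + - (sgn (toℕ j) * (c j * F (punchIn j))))
      ≡⟨ ∑-+ (suc n) (λ j → sgn (toℕ j) * (b j * F (punchIn j))) (λ j → - (sgn (toℕ j) * (c j * F (punchIn j)))) ⟩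
    expansion n b F + ∑ (suc n) (λ j → - (sgn (toℕ j) * (c j * F (punchIn j))))
      ≡⟨ cong (λ s → expansion n b F + s) (∑-neg (suc n) (λ j → sgn (toℕ j) * (c j * F (punchIn j)))) ⟩
    expansion n b F - expansion n c F ∎
    where
    distrib : ∀ s x y z → s * ((x - y) * z) ≡ s * (x * z) + - (s * (y * z))
    distrib = solve-∀

  det-cong : ∀ n {A B : Matrix n} → (∀ i l → A i l ≡ B i l) → det n A ≡ det n B
  det-cong zero    A≡B = refl
  det-cong (suc n) A≡B = ∑-cong (suc n) (λ j →
    cong₂ (λ x y → sgn (toℕ j) * (x * y)) (A≡B zero j) (det-cong n (λ i l → A≡B (suc i) (punchIn j l))))

  -- Functions of column selections that respect pointwise equality of selections; the
  -- selections produced by expanding twice agree with lifted ones only pointwise.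
  Extensional : ∀ {n m} → ((Fin n → Fin m) → ℤ) → Set
  Extensional F = ∀ {σ τ} → (∀ l → σ l ≡ τ l) → F σ ≡ F τ

  -- The determinant of a matrix whose first two rows both equal a, expanded along
  -- both of them; F σ is the minor of the remaining rows on the columns σ.
  doubleExpansion : ∀ n → (Fin (suc (suc n)) → ℤ) → ((Fin n → Fin (suc (suc n))) → ℤ) → ℤ
  doubleExpansion n a F =
    expansion (suc n) a (λ σ → expansion n (λ l → a (σ l)) (λ τ → F (λ l → σ (τ l))))

  -- The terms of doubleExpansion in which neither chosen column is column 0.
  offZeroTerms : ∀ n → (Fin (suc (suc n)) → ℤ) → ((Fin n → Fin (suc (suc n))) → ℤ) → ℤ
  offZeroTerms n a F = ∑ (suc n) (λ j → sgn (toℕ j) * (a (suc j) *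
    ∑ n (λ k → sgn (toℕ k) * (a (suc (punchIn j k)) * F (λ l → punchIn (suc j) (punchIn (suc k) l))))))

  -- The terms that use column 0 once cancel in pairs: choosing column 0 first and
  -- column j+1 second contributes the negative of choosing them in the other order.
  doubleExpansion≡offZeroTerms : ∀ n a F → doubleExpansion n a F ≡ offZeroTerms n a F
  doubleExpansion≡offZeroTerms n a F = begin
    doubleExpansion n a F
      ≡⟨⟩
    + 1 * (a zero * S) + ∑ (suc n) (λ j → sgn (toℕ (suc j)) * (a (suc j) * (+ 1 * (a zero * X j) + T j)))
      ≡⟨ cong (λ s → + 1 * (a zero * S) + s) (∑-cong (suc n) splitTerm) ⟩
    + 1 * (a zero * S) + ∑ (suc n) (λ j → - a zero * (sgn (toℕ j) * (a (suc j) * X j)) + sgn (toℕ j) * (a (suc j) * R j))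
      ≡⟨ cong (λ s → + 1 * (a zero * S) + s)
           (∑-+ (suc n) (λ j → - a zero * (sgn (toℕ j) * (a (suc j) * X j))) (λ j → sgn (toℕ j) * (a (suc j) * R j))) ⟩
    + 1 * (a zero * S) + (∑ (suc n) (λ j → - a zero * (sgn (toℕ j) * (a (suc j) * X j))) + offZeroTerms n a F)
      ≡⟨ cong (λ s → + 1 * (a zero * S) + (s + offZeroTerms n a F))
           (∑-scale (suc n) (- a zero) (λ j → sgn (toℕ j) * (a (suc j) * X j))) ⟩
    + 1 * (a zero * S) + (- a zero * S + offZeroTerms n a F)
      ≡⟨ cancel (a zero) S (offZeroTerms n a F) ⟩
    offZeroTerms n a F ∎
    where
    X : Fin (suc n) → ℤ
    X j = F (λ l → suc (punchIn j l))
    S : ℤ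
    S = ∑ (suc n) (λ j → sgn (toℕ j) * (a (suc j) * X j))
    term : Fin (suc n) → Fin n → ℤ
    term j k = a (suc (punchIn j k)) * F (λ l → punchIn (suc j) (punchIn (suc k) l))
    R T : Fin (suc n) → ℤ
    R j = ∑ n (λ k → sgn (toℕ k) * term j k)
    T j = ∑ n (λ k → sgn (toℕ (suc k)) * term j k)
    T≡-R : ∀ j → T j ≡ - R j
    T≡-R j = trans (∑-cong n (λ k → trans (cong (_* term j k) (sgn-suc (toℕ k))) (negˡ (sgn (toℕ k)) (term j k))))
                   (∑-neg n (λ k → sgn (toℕ k) * term j k))
      where
      negˡ : ∀ s y → - s * y ≡ - (s * y)
      negˡ = solve-∀
    splitTerm : ∀ j → sgn (toℕ (suc j)) * (a (suc j) * (+ 1 * (a zero * X j) + T j))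
                    ≡ - a zero * (sgn (toℕ j) * (a (suc j) * X j)) + sgn (toℕ j) * (a (suc j) * R j)
    splitTerm j = trans (cong₂ (λ s t → s * (a (suc j) * (+ 1 * (a zero * X j) + t))) (sgn-suc (toℕ j)) (T≡-R j))
                        (expand (sgn (toℕ j)) (a (suc j)) (a zero) (X j) (R j))
      where
      expand : ∀ s x a₀ y r → - s * (x * (+ 1 * (a₀ * y) + - r)) ≡ - a₀ * (s * (x * y)) + s * (x * r)
      expand = solve-∀
    cancel : ∀ a₀ s t → + 1 * (a₀ * s) + (- a₀ * s + t) ≡ t
    cancel = solve-∀

  offZeroTerms≡doubleExpansion : ∀ n a F → Extensional F →
    offZeroTerms (suc n) a F ≡ doubleExpansion n (λ i → a (suc i)) (λ σ → F (lift 1 σ))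
  offZeroTerms≡doubleExpansion n a F ext = ∑-cong (suc (suc n)) (λ j →
    cong (λ s → sgn (toℕ j) * (a (suc j) * s)) (∑-cong (suc n) (λ k →
      cong (λ y → sgn (toℕ k) * (a (suc (punchIn j k)) * y)) (ext (punchIn-lift j k)))))
    where
    punchIn-lift : ∀ j k l → punchIn (suc j) (punchIn (suc k) l) ≡ lift 1 (λ l → punchIn j (punchIn k l)) l
    punchIn-lift j k zero    = refl
    punchIn-lift j k (suc l) = refl

  doubleExpansion-vanishes : ∀ n a F → Extensional F → doubleExpansion n a F ≡ + 0
  doubleExpansion-vanishes zero a F ext = trans (doubleExpansion≡offZeroTerms zero a F) (vanish (a (suc zero)))
    where
    vanish : ∀ x → + 1 * (x * + 0) + + 0 ≡ + 0
    vanish = solve-∀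
  doubleExpansion-vanishes (suc n) a F ext = begin
    doubleExpansion (suc n) a F
      ≡⟨ doubleExpansion≡offZeroTerms (suc n) a F ⟩
    offZeroTerms (suc n) a F
      ≡⟨ offZeroTerms≡doubleExpansion n a F ext ⟩
    doubleExpansion n (λ i → a (suc i)) (λ σ → F (lift 1 σ))
      ≡⟨ doubleExpansion-vanishes n (λ i → a (suc i)) (λ σ → F (lift 1 σ)) (λ e → ext (lift-cong e)) ⟩
    + 0 ∎
    where
    lift-cong : ∀ {σ τ : Fin n → Fin (suc (suc n))} → (∀ l → σ l ≡ τ l) → ∀ l → lift 1 σ l ≡ lift 1 τ l
    lift-cong e zero    = refl
    lift-cong e (suc l) = cong suc (e l)

  det-subtractSecondRow : ∀ n (A : Matrix (suc (suc n))) →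
    expansion (suc n) (λ l → A zero l - A (suc zero) l) (lowerMinor A) ≡ det (suc (suc n)) A
  det-subtractSecondRow n A = begin
    expansion (suc n) (λ l → A zero l - A (suc zero) l) (lowerMinor A)
      ≡⟨ expansion-linear (suc n) (A zero) (A (suc zero)) (lowerMinor A) ⟩
    det (suc (suc n)) A - doubleExpansion n (A (suc zero)) lowestMinor
      ≡⟨ cong (λ x → det (suc (suc n)) A - x) (doubleExpansion-vanishes n (A (suc zero)) lowestMinor lowestMinor-ext) ⟩
    det (suc (suc n)) A - + 0
      ≡⟨ +-identityʳ (det (suc (suc n)) A) ⟩
    det (suc (suc n)) A ∎
    where
    lowestMinor : (Fin n → Fin (suc (suc n))) → ℤ
    lowestMinor ρ = det n (λ i l → A (suc (suc i)) (ρ l))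
    lowestMinor-ext : Extensional lowestMinor
    lowestMinor-ext e = det-cong n (λ i l → cong (A (suc (suc i))) (e l))

  differences : ∀ {C : Set} → ℕ → (ℕ → C → ℤ) → ℕ → C → ℤ
  differences zero    f         = f
  differences (suc s) f zero    l = f 0 l - f 1 l
  differences (suc s) f (suc i)   = differences s (λ i → f (suc i)) i

  -- These row operations preserve the determinant of the top n rows, provided the
  -- last row they read (row s) is one of them.
  det-differences : ∀ {C : Set} n s (f : ℕ → C → ℤ) (σ : Fin n → C) → s < n →
    det n (λ i l → differences s f (toℕ i) (σ l)) ≡ det n (λ i l → f (toℕ i) (σ l))
  det-differences n             zero    f σ _         = refl
  det-differences (suc zero)    (suc s) f σ (s≤s ())
  det-differences (suc (suc n)) (suc s) f σ (s≤s s<n) = begin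
    expansion (suc n) (λ l → f 0 (σ l) - f 1 (σ l))
      (λ ρ → det (suc n) (λ i l → differences s (λ i → f (suc i)) (toℕ i) (σ (ρ l))))
      ≡⟨ expansion-congʳ (suc n) (λ l → f 0 (σ l) - f 1 (σ l))
           (λ ρ → det-differences (suc n) s (λ i → f (suc i)) (λ l → σ (ρ l)) s<n) ⟩
    expansion (suc n) (λ l → f 0 (σ l) - f 1 (σ l)) (lowerMinor (λ i l → f (toℕ i) (σ l)))
      ≡⟨ det-subtractSecondRow n (λ i l → f (toℕ i) (σ l)) ⟩
    det (suc (suc n)) (λ i l → f (toℕ i) (σ l)) ∎

  differences-< : ∀ {C : Set} s (f : ℕ → C → ℤ) i l → i < s → differences s f i l ≡ f i l - f (suc i) l
  differences-< (suc s) f zero    l _         = refl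
  differences-< (suc s) f (suc i) l (s≤s i<s) = differences-< s (λ i → f (suc i)) i l i<s

  differences-≥ : ∀ {C : Set} s (f : ℕ → C → ℤ) i l → s ≤ i → differences s f i l ≡ f i l
  differences-≥ zero    f i       l _         = refl
  differences-≥ (suc s) f (suc i) l (s≤s s≤i) = differences-≥ s (λ i → f (suc i)) i l s≤i

  ∏ : ℕ → (ℕ → ℤ) → ℤ
  ∏ zero    g = + 1
  ∏ (suc n) g = g 0 * ∏ n (λ i → g (suc i))

  det-lowerTriangular : ∀ n (f : ℕ → ℕ → ℤ) (diag : ℕ → ℤ) →
    (∀ i l → i < l → f i l ≡ + 0) → (∀ i → f i i ≡ diag i) →
    det n (λ i l → f (toℕ i) (toℕ l)) ≡ ∏ n diag
  det-lowerTriangular zero    f diag upper≡0 f≡diag = refl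
  det-lowerTriangular (suc n) f diag upper≡0 f≡diag = begin
    + 1 * (f 0 0 * det n (λ i l → f (suc (toℕ i)) (suc (toℕ l)))) + ∑ n offDiagonal
      ≡⟨ cong₂ (λ x y → + 1 * x + y)
           (cong₂ _*_ (f≡diag 0) (det-lowerTriangular n (λ i l → f (suc i) (suc l)) (λ i → diag (suc i))
             (λ i l i<l → upper≡0 (suc i) (suc l) (s≤s i<l)) (λ i → f≡diag (suc i))))
           (∑-zero n offDiagonal offDiagonal≡0) ⟩
    + 1 * (diag 0 * ∏ n (λ i → diag (suc i))) + + 0
      ≡⟨ unit (diag 0) (∏ n (λ i → diag (suc i))) ⟩
    ∏ (suc n) diag ∎
    where
    offDiagonal : Fin n → ℤ
    offDiagonal j = sgn (toℕ (suc j)) * (f 0 (suc (toℕ j)) * det n (minor (λ i l → f (toℕ i) (toℕ l)) (suc j)))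
    offDiagonal≡0 : ∀ j → offDiagonal j ≡ + 0
    offDiagonal≡0 j = trans (cong (λ x → sgn (toℕ (suc j)) * (x * det n (minor (λ i l → f (toℕ i) (toℕ l)) (suc j))))
                                  (upper≡0 0 (suc (toℕ j)) (s≤s z≤n)))
                            (annihilate (sgn (toℕ (suc j))) (det n (minor (λ i l → f (toℕ i) (toℕ l)) (suc j))))
      where
      annihilate : ∀ s y → s * (+ 0 * y) ≡ + 0
      annihilate = solve-∀
    unit : ∀ x y → + 1 * (x * y) + + 0 ≡ x * y
    unit = solve-∀

module Binomial where

  open import Data.Nat using (_+_; _*_; _∸_; _≤_; s≤s; z≤n)
  open import Data.Nat.Properties using (*-identityˡ; *-zeroʳ; m≤n⇒m≤1+n; n<1+n)
  open import Data.Nat.Combinatorics using (_C_; nCk+nC[k+1]≡[n+1]C[k+1]; k>n⇒nCk≡0)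
  open import Data.Nat.Tactic.RingSolver using (solve-∀)
  open ≡-Reasoning

  binom : ℕ → ℕ → ℕ
  binom n       zero    = 1
  binom zero    (suc k) = 0
  binom (suc n) (suc k) = binom n k + binom n (suc k)

  binom≡C : ∀ n k → binom n k ≡ n C k
  binom≡C n       zero    = refl
  binom≡C zero    (suc k) = sym (k>n⇒nCk≡0 {0} {suc k} (s≤s z≤n))
  binom≡C (suc n) (suc k) = trans (cong₂ _+_ (binom≡C n k) (binom≡C n (suc k))) (nCk+nC[k+1]≡[n+1]C[k+1] n k)

  binom-> : ∀ n k → n < k → binom n k ≡ 0
  binom-> zero    (suc k) _         = refl
  binom-> (suc n) (suc k) (s≤s n<k) = cong₂ _+_ (binom-> n k n<k) (binom-> n (suc k) (m≤n⇒m≤1+n n<k))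

  binom-diag : ∀ n → binom n n ≡ 1
  binom-diag zero    = refl
  binom-diag (suc n) = cong₂ _+_ (binom-diag n) (binom-> n (suc n) (n<1+n n))

  absorption : ∀ n k → suc k * binom (suc n) (suc k) ≡ suc n * binom n k
  absorption zero    zero    = refl
  absorption zero    (suc k) = *-zeroʳ (suc (suc k))
  absorption (suc n) zero    = begin
    1 * (1 + binom (suc n) 1) ≡⟨ cong (λ x → 1 * (1 + x)) (trans (sym (*-identityˡ (binom (suc n) 1))) (absorption n 0)) ⟩
    1 * (1 + suc n * 1)       ≡⟨ simplify n ⟩
    suc (suc n) * 1           ∎
    where
    simplify : ∀ n → 1 * (1 + suc n * 1) ≡ suc (suc n) * 1
    simplify = solve-∀
  absorption (suc n) (suc k) = begin
    suc (suc k) * (binom (suc n) (suc k) + binom (suc n) (suc (suc k)))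
      ≡⟨ split k (binom (suc n) (suc k)) (binom (suc n) (suc (suc k))) ⟩
    binom (suc n) (suc k) + suc k * binom (suc n) (suc k) + suc (suc k) * binom (suc n) (suc (suc k))
      ≡⟨ cong₂ (λ x y → binom (suc n) (suc k) + x + y) (absorption n k) (absorption n (suc k)) ⟩
    binom (suc n) (suc k) + suc n * binom n k + suc n * binom n (suc k)
      ≡⟨ merge n (binom (suc n) (suc k)) (binom n k) (binom n (suc k)) ⟩
    suc (suc n) * binom (suc n) (suc k) ∎
    where
    split : ∀ k x y → suc (suc k) * (x + y) ≡ x + suc k * x + suc (suc k) * y
    split = solve-∀
    merge : ∀ n a b c → a + suc n * b + suc n * c ≡ a + suc n * (b + c)
    merge = solve-∀

  -- binom∸ n k s = C(n, k − s), taken to be 0 when k < s.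
  binom∸ : ℕ → ℕ → ℕ → ℕ
  binom∸ n k       zero    = binom n k
  binom∸ n zero    (suc s) = 0
  binom∸ n (suc k) (suc s) = binom∸ n k s

  binom∸-pascal : ∀ n k s → binom∸ (suc n) (suc k) s ≡ binom∸ n k s + binom∸ n (suc k) s
  binom∸-pascal n k       zero          = refl
  binom∸-pascal n zero    (suc zero)    = refl
  binom∸-pascal n zero    (suc (suc s)) = refl
  binom∸-pascal n (suc k) (suc s)       = binom∸-pascal n k s

  binom∸-< : ∀ n k s → k < s → binom∸ n k s ≡ 0
  binom∸-< n zero    (suc s) _         = refl
  binom∸-< n (suc k) (suc s) (s≤s k<s) = binom∸-< n k s k<s

  binom∸-≥ : ∀ n k s → s ≤ k → binom∸ n k s ≡ binom n (k ∸ s)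
  binom∸-≥ n k       zero    _         = refl
  binom∸-≥ n (suc k) (suc s) (s≤s s≤k) = binom∸-≥ n k s s≤k

  binom∸-diag : ∀ n s → binom∸ n s s ≡ 1
  binom∸-diag n zero    = refl
  binom∸-diag n (suc s) = binom∸-diag n s

-- For m ≤ r the (m+1)×(m+1) matrix [c_l · C(r − i, m − l)] (0 ≤ i, l ≤ m) has determinant
-- ∏ c_l.  Subtracting from each row the next one (Pascal's rule) m times turns it into the
-- lower triangular matrix [c_l · C(r − m, i − l)].  The intermediate matrices are the
-- stages h = m, …, 0 below, with y = r − m: rows i ≤ h hold c_l · C(y + h − i, h − l) and
-- rows i ≥ h hold c_l · C(y, i − l), where C(n, negative) = 0.
module BinomialBlock where

  open import Data.Nat using (_+_; _∸_; _⊔_; _≤_; s≤s)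
  open import Data.Nat.Properties
    using (_≤?_; ≰⇒>; ≤-refl; ≤-trans; ≤-pred; n≤1+n; m≤n⇒m≤1+n;
           +-∸-assoc; +-suc; +-identityʳ; m∸n+n≡m; 0∸n≡0; m≥n⇒m⊔n≡m; m≤n⇒m⊔n≡n; m≤n⇒m∸n≡0)
  open import Data.Fin.Properties using (toℕ<n)
  open import Data.Integer as ℤ using (ℤ; +_; _*_; _-_)
  open import Data.Integer.Properties using (*-zeroʳ; *-identityʳ)
  open import Data.Integer.Tactic.RingSolver using (solve-∀)
  open import Relation.Nullary using (yes; no)
  open Binomial
  open Determinant
  open ≡-Reasoning

  stageEntry : ℕ → ℕ → ℕ → ℕ → ℕ
  stageEntry y h i l = binom∸ (y + (h ∸ i)) (h ⊔ i) l

  stage : ℕ → (ℕ → ℤ) → ℕ → ℕ → ℕ → ℤ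
  stage y c h i l = c l * + stageEntry y h i l

  -- Pascal's rule links consecutive stages in the rows that are still changing …
  stageEntry-pascal : ∀ y h i l → i ≤ h → stageEntry y (suc h) i l ≡ stageEntry y h i l + stageEntry y (suc h) (suc i) l
  stageEntry-pascal y h i l i≤h = begin
    binom∸ (y + (suc h ∸ i)) (suc h ⊔ i) l
      ≡⟨ cong₂ (λ a b → binom∸ a b l) (trans (cong (λ a → y + a) (+-∸-assoc 1 i≤h)) (+-suc y (h ∸ i)))
               (m≥n⇒m⊔n≡m (m≤n⇒m≤1+n i≤h)) ⟩
    binom∸ (suc (y + (h ∸ i))) (suc h) l
      ≡⟨ binom∸-pascal (y + (h ∸ i)) h l ⟩
    binom∸ (y + (h ∸ i)) h l + binom∸ (y + (h ∸ i)) (suc h) l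
      ≡⟨ cong (λ b → binom∸ (y + (h ∸ i)) b l + binom∸ (y + (h ∸ i)) (suc b) l) (sym (m≥n⇒m⊔n≡m i≤h)) ⟩
    stageEntry y h i l + stageEntry y (suc h) (suc i) l ∎

  stageEntry-settled : ∀ y h i l → suc h ≤ i → stageEntry y (suc h) i l ≡ stageEntry y h i l
  stageEntry-settled y h i l h<i = cong₂ (λ a b → binom∸ (y + a) b l)
    (trans (m≤n⇒m∸n≡0 h<i) (sym (m≤n⇒m∸n≡0 (≤-trans (n≤1+n h) h<i))))
    (trans (m≤n⇒m⊔n≡n h<i) (sym (m≤n⇒m⊔n≡n (≤-trans (n≤1+n h) h<i))))

  differences-stage : ∀ y c h i l → differences (suc h) (stage y c (suc h)) i l ≡ stage y c h i l
  differences-stage y c h i l with i ≤? h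
  ... | yes i≤h = begin
    differences (suc h) (stage y c (suc h)) i l
      ≡⟨ differences-< (suc h) (stage y c (suc h)) i l (s≤s i≤h) ⟩
    c l * + stageEntry y (suc h) i l - c l * + stageEntry y (suc h) (suc i) l
      ≡⟨ cong (λ x → c l * + x - c l * + stageEntry y (suc h) (suc i) l) (stageEntry-pascal y h i l i≤h) ⟩
    c l * + (stageEntry y h i l + stageEntry y (suc h) (suc i) l) - c l * + stageEntry y (suc h) (suc i) l
      ≡⟨ cancel (c l) (+ stageEntry y h i l) (+ stageEntry y (suc h) (suc i) l) ⟩
    stage y c h i l ∎
    where
    cancel : ∀ a x z → a * (x ℤ.+ z) - a * z ≡ a * x
    cancel = solve-∀
  ... | no i≰h = trans (differences-≥ (suc h) (stage y c (suc h)) i l (≰⇒> i≰h))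
                       (cong (λ x → c l * + x) (stageEntry-settled y h i l (≰⇒> i≰h)))

  det-stage : ∀ y c m h → h < m →
    det m (λ i l → stage y c h (toℕ i) (toℕ l)) ≡ det m (λ i l → stage y c 0 (toℕ i) (toℕ l))
  det-stage y c m zero    _   = refl
  det-stage y c m (suc h) h<m = begin
    det m (λ i l → stage y c (suc h) (toℕ i) (toℕ l))
      ≡⟨ det-differences m (suc h) (stage y c (suc h)) toℕ h<m ⟨
    det m (λ i l → differences (suc h) (stage y c (suc h)) (toℕ i) (toℕ l))
      ≡⟨ det-cong m (λ i l → differences-stage y c h (toℕ i) (toℕ l)) ⟩
    det m (λ i l → stage y c h (toℕ i) (toℕ l))
      ≡⟨ det-stage y c m h (≤-trans (n≤1+n (suc h)) h<m) ⟩
    det m (λ i l → stage y c 0 (toℕ i) (toℕ l)) ∎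

  det-stage₀ : ∀ y c m → det m (λ i l → stage y c 0 (toℕ i) (toℕ l)) ≡ ∏ m c
  det-stage₀ y c m = det-lowerTriangular m (stage y c 0) c upper≡0 diagonal
    where
    entry₀ : ∀ i l → stageEntry y 0 i l ≡ binom∸ y i l
    entry₀ i l = cong (λ a → binom∸ a i l) (trans (cong (λ a → y + a) (0∸n≡0 i)) (+-identityʳ y))
    upper≡0 : ∀ i l → i < l → stage y c 0 i l ≡ + 0
    upper≡0 i l i<l = trans (cong (λ x → c l * + x) (trans (entry₀ i l) (binom∸-< y i l i<l))) (*-zeroʳ (c l))
    diagonal : ∀ i → stage y c 0 i i ≡ c i
    diagonal i = trans (cong (λ x → c i * + x) (trans (entry₀ i i) (binom∸-diag y i))) (*-identityʳ (c i))

  -- The last stage m is the binomial block itself.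
  det-binomialBlock : ∀ m r (c : ℕ → ℤ) → m ≤ r →
    det (suc m) (λ i l → c (toℕ l) * + binom (r ∸ toℕ i) (m ∸ toℕ l)) ≡ ∏ (suc m) c
  det-binomialBlock m r c m≤r = begin
    det (suc m) (λ i l → c (toℕ l) * + binom (r ∸ toℕ i) (m ∸ toℕ l))
      ≡⟨ det-cong (suc m) (λ i l → cong (λ x → c (toℕ l) * + x)
           (lastStage (toℕ i) (toℕ l) (≤-pred (toℕ<n i)) (≤-pred (toℕ<n l)))) ⟩
    det (suc m) (λ i l → stage (r ∸ m) c m (toℕ i) (toℕ l))
      ≡⟨ det-stage (r ∸ m) c (suc m) m (s≤s ≤-refl) ⟩
    det (suc m) (λ i l → stage (r ∸ m) c 0 (toℕ i) (toℕ l))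
      ≡⟨ det-stage₀ (r ∸ m) c (suc m) ⟩
    ∏ (suc m) c ∎
    where
    lastStage : ∀ i l → i ≤ m → l ≤ m → binom (r ∸ i) (m ∸ l) ≡ stageEntry (r ∸ m) m i l
    lastStage i l i≤m l≤m = sym (begin
      binom∸ (r ∸ m + (m ∸ i)) (m ⊔ i) l ≡⟨ cong₂ (λ a b → binom∸ a b l) rows (m≥n⇒m⊔n≡m i≤m) ⟩
      binom∸ (r ∸ i) m l                 ≡⟨ binom∸-≥ (r ∸ i) m l l≤m ⟩
      binom (r ∸ i) (m ∸ l)              ∎)
      where
      rows : r ∸ m + (m ∸ i) ≡ r ∸ i
      rows = sym (trans (cong (_∸ i) (sym (m∸n+n≡m m≤r))) (+-∸-assoc (r ∸ m) i≤m))

module Congruence (p : ℕ) where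

  open import Data.Nat as ℕ using (NonZero; _%_; _/_)
  open import Data.Nat.DivMod using (m≡m%n+[m/n]*n)
  open import Data.Integer using (ℤ; +_; _+_; _*_; -_; _-_; ∣_∣)
  open import Data.Integer.Properties using (pos-+; pos-*)
  open import Data.Integer.Divisibility.Signed
    using (divides; ∣m∣n⇒∣m+n; ∣m∣n⇒∣m-n; ∣m⇒∣-m; ∣n⇒∣m*n; ∣m⇒∣m*n; ∣ᵤ⇒∣; ∣⇒∣ᵤ)
    renaming (_∣_ to _∣ℤ_)
  open import Data.Integer.Tactic.RingSolver using (solve-∀)
  open import Relation.Binary.Bundles using (Setoid)

  infix 4 _≋_
  record _≋_ (a b : ℤ) : Set where
    constructor congruent
    field p∣difference : + p ∣ℤ a - b

  ≋-reflexive : ∀ {a b} → a ≡ b → a ≋ b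
  ≋-reflexive {a} refl = congruent (divides (+ 0) (self-difference a (+ p)))
    where
    self-difference : ∀ a q → a - a ≡ + 0 * q
    self-difference = solve-∀

  ≋-refl : ∀ {a} → a ≋ a
  ≋-refl = ≋-reflexive refl

  ≋-sym : ∀ {a b} → a ≋ b → b ≋ a
  ≋-sym {a} {b} (congruent d) = congruent (subst (+ p ∣ℤ_) (flip a b) (∣m⇒∣-m d))
    where
    flip : ∀ a b → - (a - b) ≡ b - a
    flip = solve-∀

  ≋-trans : ∀ {a b c} → a ≋ b → b ≋ c → a ≋ c
  ≋-trans {a} {b} {c} (congruent d₁) (congruent d₂) = congruent (subst (+ p ∣ℤ_) (telescope a b c) (∣m∣n⇒∣m+n d₁ d₂))
    where
    telescope : ∀ a b c → (a - b) + (b - c) ≡ a - c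
    telescope = solve-∀

  ≋-+ : ∀ {a b c d} → a ≋ b → c ≋ d → a + c ≋ b + d
  ≋-+ {a} {b} {c} {d} (congruent d₁) (congruent d₂) = congruent (subst (+ p ∣ℤ_) (regroup a b c d) (∣m∣n⇒∣m+n d₁ d₂))
    where
    regroup : ∀ a b c d → (a - b) + (c - d) ≡ (a + c) - (b + d)
    regroup = solve-∀

  ≋-* : ∀ {a b c d} → a ≋ b → c ≋ d → a * c ≋ b * d
  ≋-* {a} {b} {c} {d} (congruent d₁) (congruent d₂) =
    congruent (subst (+ p ∣ℤ_) (regroup a b c d) (∣m∣n⇒∣m+n (∣n⇒∣m*n a d₂) (∣m⇒∣m*n d d₁)))
    where
    regroup : ∀ a b c d → a * (c - d) + (a - b) * d ≡ a * c - b * d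
    regroup = solve-∀

  ≋-setoid : Setoid _ _
  ≋-setoid = record
    { Carrier = ℤ ; _≈_ = _≋_
    ; isEquivalence = record { refl = ≋-refl ; sym = ≋-sym ; trans = ≋-trans } }

  multiple≋0 : ∀ {x} → p ∣ x → + x ≋ + 0
  multiple≋0 {x} p∣x = congruent (subst (+ p ∣ℤ_) (minus-zero (+ x)) (∣ᵤ⇒∣ p∣x))
    where
    minus-zero : ∀ a → a ≡ a - + 0
    minus-zero = solve-∀

  %-≋ : ∀ x .{{_ : NonZero p}} → + (x % p) ≋ + x
  %-≋ x = ≋-sym (congruent (divides (+ (x / p)) (begin
    + x - + (x % p)                          ≡⟨ cong (λ y → + y - + (x % p)) (m≡m%n+[m/n]*n x p) ⟩
    + (x % p ℕ.+ x / p ℕ.* p) - + (x % p)    ≡⟨ cong (λ y → y - + (x % p)) (pos-+ (x % p) (x / p ℕ.* p)) ⟩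
    + (x % p) + + (x / p ℕ.* p) - + (x % p)  ≡⟨ cong (λ y → + (x % p) + y - + (x % p)) (pos-* (x / p) p) ⟩
    + (x % p) + + (x / p) * + p - + (x % p)  ≡⟨ cancel (+ (x % p)) (+ (x / p)) (+ p) ⟩
    + (x / p) * + p                          ∎)))
    where
    open ≡-Reasoning
    cancel : ∀ r t q → r + t * q - r ≡ t * q
    cancel = solve-∀

  ∣-≋ : ∀ {a b} → a ≋ b → p ∣ ∣ a ∣ → p ∣ ∣ b ∣
  ∣-≋ {a} {b} (congruent p∣a-b) p∣a =
    ∣⇒∣ᵤ (subst (+ p ∣ℤ_) (cancel a b) (∣m∣n⇒∣m-n {+ p} {a} (∣ᵤ⇒∣ {+ p} {a} p∣a) p∣a-b))
    where
    cancel : ∀ a b → a - (a - b) ≡ b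
    cancel = solve-∀

  ∑-≋ : ∀ n {f g : Fin n → ℤ} → (∀ i → f i ≋ g i) → ∑ n f ≋ ∑ n g
  ∑-≋ zero    f≋g = ≋-refl
  ∑-≋ (suc n) f≋g = ≋-+ (f≋g zero) (∑-≋ n (λ i → f≋g (suc i)))

  det-≋ : ∀ n {A B : Matrix n} → (∀ i l → A i l ≋ B i l) → det n A ≋ det n B
  det-≋ zero    A≋B = ≋-refl
  det-≋ (suc n) A≋B = ∑-≋ (suc n) (λ j →
    ≋-* (≋-refl {sgn (toℕ j)}) (≋-* (A≋B zero j) (det-≋ n (λ i l → A≋B (suc i) (punchIn j l)))))

-- Lucas' theorem for one digit: if p divides C(q,k) for all 0 < k < q, i.e.
-- (1+x)^q ≡ 1 + x^q (mod p), then C(aq+b, cq+t) ≡ C(a,c)·C(b,t) for b, t < q.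
module Lucas (p q : ℕ) (0<q : 0 < q)
             (frobenius : ∀ k → 0 < k → k < q → p ∣ Binomial.binom q k) where

  open import Data.Nat using (_+_; _*_; _∸_; s≤s; z≤n)
  open import Data.Nat.Properties
    using (<-cmp; <⇒≤; +-identityʳ; m≤m+n; ≤-trans; <-≤-trans; m<n⇒0<n∸m; m+n∸n≡m)
  open import Data.Nat.Tactic.RingSolver using (solve-∀)
  open import Data.Integer using (+_)
  open import Relation.Binary.Definitions using (tri<; tri≈; tri>)
  open Binomial
  open Congruence p
  open import Relation.Binary.Reasoning.Setoid ≋-setoid

  -- (1+x)^q ≡ 1 + x^q, coefficientwise.
  binom-q : ∀ k → + binom q k ≋ + (binom 0 k + binom∸ 0 k q)
  binom-q zero = ≋-reflexive (cong (λ x → + (1 + x)) (sym (binom∸-< 0 0 q 0<q)))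
  binom-q (suc k) with <-cmp (suc k) q
  ... | tri< k<q _ _ = ≋-trans (multiple≋0 (frobenius (suc k) (s≤s z≤n) k<q))
                               (≋-reflexive (cong +_ (sym (binom∸-< 0 (suc k) q k<q))))
  ... | tri≈ _ k≡q _ rewrite sym k≡q = ≋-reflexive (cong +_ (trans (binom-diag (suc k)) (sym (binom∸-diag 0 (suc k)))))
  ... | tri> _ _ q<k = ≋-reflexive (cong +_ (trans (binom-> q (suc k) q<k)
                         (sym (trans (binom∸-≥ 0 (suc k) q (<⇒≤ q<k)) (binom-> 0 (suc k ∸ q) (m<n⇒0<n∸m q<k))))))

  -- (1+x)^(n+q) ≡ (1+x)^n + x^q (1+x)^n, coefficientwise.
  binom-+q : ∀ n k → + binom (n + q) k ≋ + (binom n k + binom∸ n k q)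
  binom-+q zero    k       = binom-q k
  binom-+q (suc n) zero    = ≋-reflexive (cong (λ x → + (1 + x)) (sym (binom∸-< (suc n) 0 q 0<q)))
  binom-+q (suc n) (suc k) = begin
    + binom (suc n + q) (suc k)
      ≈⟨ ≋-+ (binom-+q n k) (binom-+q n (suc k)) ⟩
    + (binom n k + binom∸ n k q + (binom n (suc k) + binom∸ n (suc k) q))
      ≡⟨ cong +_ (regroup (binom n k) (binom∸ n k q) (binom n (suc k)) (binom∸ n (suc k) q)) ⟩
    + (binom (suc n) (suc k) + (binom∸ n k q + binom∸ n (suc k) q))
      ≡⟨ cong (λ x → + (binom (suc n) (suc k) + x)) (sym (binom∸-pascal n k q)) ⟩
    + (binom (suc n) (suc k) + binom∸ (suc n) (suc k) q) ∎
    where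
    regroup : ∀ a b c d → a + b + (c + d) ≡ a + c + (b + d)
    regroup = solve-∀

  lucas : ∀ a b c t → b < q → t < q → + binom (a * q + b) (c * q + t) ≋ + (binom a c * binom b t)
  lucas zero    b zero    t b<q t<q = ≋-reflexive (cong +_ (sym (+-identityʳ (binom b t))))
  lucas zero    b (suc c) t b<q t<q = ≋-reflexive (cong +_ (binom-> b (suc c * q + t)
                                        (<-≤-trans b<q (≤-trans (m≤m+n q (c * q)) (m≤m+n (suc c * q) t)))))
  lucas (suc a) b c       t b<q t<q = begin
    + binom (suc a * q + b) (c * q + t)
      ≡⟨ cong (λ n → + binom n (c * q + t)) (shift a q b) ⟩
    + binom (a * q + b + q) (c * q + t)
      ≈⟨ binom-+q (a * q + b) (c * q + t) ⟩
    + (binom (a * q + b) (c * q + t) + binom∸ (a * q + b) (c * q + t) q)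
      ≈⟨ lowerDigit c ⟩
    + (binom (suc a) c * binom b t) ∎
    where
    shift : ∀ a q b → suc a * q + b ≡ a * q + b + q
    shift = solve-∀
    lowerDigit : ∀ c → + (binom (a * q + b) (c * q + t) + binom∸ (a * q + b) (c * q + t) q)
                       ≋ + (binom (suc a) c * binom b t)
    lowerDigit zero = begin
      + (binom (a * q + b) t + binom∸ (a * q + b) t q)
        ≈⟨ ≋-+ (lucas a b zero t b<q t<q) (≋-reflexive (cong +_ (binom∸-< (a * q + b) t q t<q))) ⟩
      + (1 * binom b t + 0)
        ≡⟨ cong +_ (+-identityʳ (1 * binom b t)) ⟩
      + (1 * binom b t) ∎
    lowerDigit (suc c) = begin
      + (binom (a * q + b) (suc c * q + t) + binom∸ (a * q + b) (suc c * q + t) q)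
        ≡⟨ cong (λ x → + (binom (a * q + b) (suc c * q + t) + x))
             (binom∸-≥ (a * q + b) (suc c * q + t) q (≤-trans (m≤m+n q (c * q)) (m≤m+n (suc c * q) t))) ⟩
      + (binom (a * q + b) (suc c * q + t) + binom (a * q + b) (suc c * q + t ∸ q))
        ≡⟨ cong (λ k → + (binom (a * q + b) (suc c * q + t) + binom (a * q + b) k)) (digitShift c q t) ⟩
      + (binom (a * q + b) (suc c * q + t) + binom (a * q + b) (c * q + t))
        ≈⟨ ≋-+ (lucas a b (suc c) t b<q t<q) (lucas a b c t b<q t<q) ⟩
      + (binom a (suc c) * binom b t + binom a c * binom b t)
        ≡⟨ cong +_ (collect (binom a (suc c)) (binom a c) (binom b t)) ⟩
      + (binom (suc a) (suc c) * binom b t) ∎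
      where
      digitShift : ∀ c q t → suc c * q + t ∸ q ≡ c * q + t
      digitShift c q t = trans (cong (_∸ q) (reorder c q t)) (m+n∸n≡m (c * q + t) q)
        where
        reorder : ∀ c q t → suc c * q + t ≡ c * q + t + q
        reorder = solve-∀
      collect : ∀ x y z → x * z + y * z ≡ (y + x) * z
      collect = solve-∀

module PrimeFacts (p : ℕ) (prime : Prime p) where

  open import Data.Nat using (_*_; _∸_; _^_; _≤_; _!; s≤s; z≤n; nonTrivial⇒n>1)
  open import Data.Nat.Properties
    using (*-comm; *-assoc; <⇒≢; <⇒≱; <-trans; n<1+n; _!*_!≢0)
  open import Data.Nat.Divisibility
    using (divides; _∣?_; 1∣_; ∣1⇒≡1; ∣⇒≤; ∣-trans; m∣m*n; *-monoʳ-∣; *-cancelˡ-∣)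
  open import Data.Nat.DivMod using (m/n*n≡m)
  open import Data.Nat.Primality using (euclidsLemma; prime⇒nonZero; prime⇒nonTrivial)
  open import Data.Nat.Combinatorics using (nCk≡n!/k![n-k]!; k![n∸k]!∣n!)
  open import Data.Integer using (ℤ; ∣_∣)
  open import Data.Integer.Properties using (abs-*)
  open import Data.Sum using (inj₁; inj₂)
  open import Relation.Nullary using (¬_; contradiction)
  open import Relation.Nullary.Decidable using (decidable-stable)
  open Binomial
  open Determinant using (∏)

  p∤1 : ¬ p ∣ 1
  p∤1 p∣1 = <⇒≢ (nonTrivial⇒n>1 p {{prime⇒nonTrivial prime}}) (sym (∣1⇒≡1 p∣1))

  prime-power-cancel : ∀ e k c → ¬ p ∣ c → p ^ e ∣ k * c → p ^ e ∣ k
  prime-power-cancel zero    k c p∤c _      = 1∣ k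
  prime-power-cancel (suc e) k c p∤c pᵉ⁺¹∣kc with euclidsLemma k c prime (∣-trans (m∣m*n (p ^ e)) pᵉ⁺¹∣kc)
  ... | inj₂ p∣c = contradiction p∣c p∤c
  ... | inj₁ (divides k′ refl) = subst (p * p ^ e ∣_) (*-comm p k′)
          (*-monoʳ-∣ p (prime-power-cancel e k′ c p∤c (*-cancelˡ-∣ p (subst (p * p ^ e ∣_) (rearrange k′) pᵉ⁺¹∣kc))))
    where
    instance _ = prime⇒nonZero prime
    rearrange : ∀ k′ → k′ * p * c ≡ p * (k′ * c)
    rearrange k′ = trans (cong (_* c) (*-comm k′ p)) (*-assoc p k′ c)

  -- p divides C(p^e, k) for 0 < k < p^e, since k·C(q,k) = q·C(q−1,k−1) with q = p^e.
  p∣binom-prime-power : ∀ e q → q ≡ p ^ e → ∀ k → 0 < k → k < q → p ∣ binom q k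
  p∣binom-prime-power e (suc n) q≡pᵉ (suc k) _ k<q =
    decidable-stable (p ∣? binom (suc n) (suc k)) (λ p∤ → <⇒≱ k<q (∣⇒≤ (q∣k p∤)))
    where
    q∣k : ¬ p ∣ binom (suc n) (suc k) → suc n ∣ suc k
    q∣k p∤ = subst (_∣ suc k) (sym q≡pᵉ) (prime-power-cancel e (suc k) (binom (suc n) (suc k)) p∤
               (subst (_∣ suc k * binom (suc n) (suc k)) q≡pᵉ
                 (subst (suc n ∣_) (sym (absorption n k)) (m∣m*n (binom n k)))))

  -- d! is a product of numbers below p.
  p∤factorial : ∀ d → d < p → ¬ p ∣ d !
  p∤factorial zero    _   p∣1 = p∤1 p∣1
  p∤factorial (suc d) d<p p∣d! with euclidsLemma (suc d) (d !) prime p∣d!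
  ... | inj₁ p∣d+1 = <⇒≱ d<p (∣⇒≤ p∣d+1)
  ... | inj₂ p∣d!  = p∤factorial d (<-trans (n<1+n d) d<p) p∣d!

  -- For d < p, p divides no C(d, j): it would divide d! = C(d,j)·j!·(d−j)!.
  p∤binom : ∀ d j → j ≤ d → d < p → ¬ p ∣ binom d j
  p∤binom d j j≤d d<p p∣binom =
    p∤factorial d d<p (subst (p ∣_) binom·factorials (∣-trans p∣binom (m∣m*n (j ! * (d ∸ j) !))))
    where
    instance _ = j !* (d ∸ j) !≢0
    binom·factorials : binom d j * (j ! * (d ∸ j) !) ≡ d !
    binom·factorials = trans (cong (_* (j ! * (d ∸ j) !)) (trans (binom≡C d j) (nCk≡n!/k![n-k]! j≤d)))
                             (m/n*n≡m (k![n∸k]!∣n! j≤d))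

  p∤∏ : ∀ n (g : ℕ → ℤ) → (∀ i → i < n → ¬ p ∣ ∣ g i ∣) → ¬ p ∣ ∣ ∏ n g ∣
  p∤∏ zero    g p∤g p∣1 = p∤1 p∣1
  p∤∏ (suc n) g p∤g p∣∏
    with euclidsLemma ∣ g 0 ∣ ∣ ∏ n (λ i → g (suc i)) ∣ prime (subst (p ∣_) (abs-* (g 0) _) p∣∏)
  ... | inj₁ p∣g₀ = p∤g 0 (s≤s z≤n) p∣g₀
  ... | inj₂ p∣∏′ = p∤∏ n (λ i → g (suc i)) (λ i i<n → p∤g (suc i) (s≤s i<n)) p∣∏′

module Corollary (p : ℕ) (prime : Prime p) where

  open import Data.Nat using (_+_; _*_; _∸_; _^_; _≤_; s≤s; z≤n)
  open import Data.Nat.Properties using (≤-trans; ≤-<-trans; ≤-pred; m∸n≤m; +-∸-assoc; m+[n∸m]≡n)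
  open import Data.Nat.Combinatorics using (_C_)
  open import Data.Nat.Primality using (prime⇒nonZero)
  open import Data.Nat.Tactic.RingSolver using (solve-∀)
  open import Data.Fin.Properties using (toℕ<n)
  open import Data.Integer as ℤ using (+_)
  open import Data.Integer.Properties using (pos-*)
  open Binomial
  open Congruence p
  open BinomialBlock using (det-binomialBlock)
  open Determinant using (∏)

  -- With k = dq + r and m = m′+1: C(k − i, m + (l+1)(q−1)) = C(dq + (r−i), (l+1)q + (m′−l))
  -- ≡ C(d, l+1)·C(r−i, m′−l), both lower digits being < q.
  entry-lucas : ∀ e q₀ → suc q₀ ≡ p ^ e → ∀ d r m′ → r < suc q₀ → m′ ≤ r →
                ∀ i l → i ≤ m′ → l ≤ m′ →
    + ((d * suc q₀ + r ∸ i) C (suc m′ + suc l * q₀)) ≋ + binom d (suc l) ℤ.* + binom (r ∸ i) (m′ ∸ l)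
  entry-lucas e q₀ q≡pᵉ d r m′ r<q m′≤r i l i≤m′ l≤m′ = begin
    + ((d * q + r ∸ i) C (suc m′ + suc l * q₀))
      ≡⟨ cong +_ (sym (binom≡C (d * q + r ∸ i) (suc m′ + suc l * q₀))) ⟩
    + binom (d * q + r ∸ i) (suc m′ + suc l * q₀)
      ≡⟨ cong₂ (λ n k → + binom n k) (+-∸-assoc (d * q) (≤-trans i≤m′ m′≤r)) digits ⟩
    + binom (d * q + (r ∸ i)) (suc l * q + (m′ ∸ l))
      ≈⟨ lucas d (r ∸ i) (suc l) (m′ ∸ l) (≤-<-trans (m∸n≤m r i) r<q)
               (≤-<-trans (≤-trans (m∸n≤m m′ l) m′≤r) r<q) ⟩
    + (binom d (suc l) * binom (r ∸ i) (m′ ∸ l))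
      ≡⟨ pos-* (binom d (suc l)) (binom (r ∸ i) (m′ ∸ l)) ⟩
    + binom d (suc l) ℤ.* + binom (r ∸ i) (m′ ∸ l) ∎
    where
    q = suc q₀
    open Lucas p q (s≤s z≤n) (PrimeFacts.p∣binom-prime-power p prime e q q≡pᵉ)
    open import Relation.Binary.Reasoning.Setoid ≋-setoid
    digits : suc m′ + suc l * q₀ ≡ suc l * q + (m′ ∸ l)
    digits = trans (cong (λ x → suc x + suc l * q₀) (sym (m+[n∸m]≡n l≤m′))) (regroup l (m′ ∸ l) q₀)
      where
      regroup : ∀ l t q₀ → suc (l + t) + suc l * q₀ ≡ suc l * suc q₀ + t
      regroup = solve-∀

  det-binomMatrix : ∀ e q₀ → suc q₀ ≡ p ^ e → ∀ d r m′ → r < suc q₀ → m′ ≤ r →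
    det (suc m′) (binomMatrix p prime (d * suc q₀ + r) (suc q₀) (suc m′)) ≋ ∏ (suc m′) (λ l → + binom d (suc l))
  det-binomMatrix e q₀ q≡pᵉ d r m′ r<q m′≤r = ≋-trans (det-≋ (suc m′) entries)
    (≋-reflexive (det-binomialBlock m′ r (λ l → + binom d (suc l)) m′≤r))
    where
    instance _ = prime⇒nonZero prime
    entries : ∀ i l → binomMatrix p prime (d * suc q₀ + r) (suc q₀) (suc m′) i l
                      ≋ + binom d (suc (toℕ l)) ℤ.* + binom (r ∸ toℕ i) (m′ ∸ toℕ l)
    entries i l = ≋-trans (%-≋ _)
      (entry-lucas e q₀ q≡pᵉ d r m′ r<q m′≤r (toℕ i) (toℕ l) (≤-pred (toℕ<n i)) (≤-pred (toℕ<n l)))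

open import Data.Nat using (_+_; _*_; _∸_; _^_; _≤_)
open import Data.Nat.Properties using (≤-trans; ∸-monoˡ-≤)
open import Data.Integer using (ℤ; +_; ∣_∣)
open import Relation.Nullary using (¬_)

corollary4p17 : (p : ℕ) (pp : Prime p) (e q : ℕ) → q ≡ p ^ e →
    (k d r : ℕ) → k ≡ d * q + r → 1 ≤ d → d < p → r < q →
    d ∸ 1 ≤ r →
    (m : ℕ) → 1 ≤ m → m ≤ d →
    NonsingularModP p m (binomMatrix p pp k q m)
corollary4p17 p pp e zero     _    k d r _    _ _   ()  _      m        _ _
corollary4p17 p pp e (suc q₀) _    k d r _    _ _   _   _      zero     () _
corollary4p17 p pp e (suc q₀) q≡pᵉ _ d r refl _ d<p r<q d∸1≤r (suc m′) _ m≤d p∣det =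
  p∤∏ (suc m′) c p∤c (∣-≋ det≋∏c p∣det)
  where
  open Binomial using (binom)
  open Congruence p using (_≋_; ∣-≋)
  open PrimeFacts p pp using (p∤∏; p∤binom)
  open Determinant using (∏)
  open Corollary p pp using (det-binomMatrix)

  c : ℕ → ℤ
  c l = + binom d (suc l)

  det≋∏c : det (suc m′) (binomMatrix p pp (d * suc q₀ + r) (suc q₀) (suc m′)) ≋ ∏ (suc m′) c
  det≋∏c = det-binomMatrix e q₀ q≡pᵉ d r m′ r<q (≤-trans (∸-monoˡ-≤ 1 m≤d) d∸1≤r)

  p∤c : ∀ l → l < suc m′ → ¬ p ∣ ∣ c l ∣
  p∤c l l<m = p∤binom d (suc l) (≤-trans l<m m≤d) d<p
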